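{- Let $q>17$ be a power of an odd prime with $3\nmid q-1$, let $\lambda\in\mathbb{F}_q$ be a non-square, let $a\in\mathbb{F}_q$ and $f=X^3+a$. Suppose that $\mathcal{G}(\lambda,f)$ is connected. Then $\mathcal{G}(\lambda,f)$ has no Hamiltonian cycle of Type 1.
   Context: For a polynomial $f\in\mathbb{F}_q[X]$ and a non-square $\lambda\in\mathbb{F}_q$, $\mathcal{G}(\lambda,f)$ is the directed graph with vertex set $\mathbb{F}_q$ and an edge from $x$ to $y$ iff $(y^2-f(x))(\lambda y^2-f(x))=0$ (loops allowed); connected means weakly connected. Weights: an edge $(x,y)$ has weight $0$ if $y^2=f(x)$ and weight $1$ otherwise (so the edge into vertex $0$ has weight $0$). A trail is a directed path all of whose edges have the same weight; its length is its number of edges. A directed path is of Type $n$ if it contains a trail of length $n$ but no trail of length greater than $n$. A Hamiltonian cycle $H$ of a connected component is of Type $n$ if $H\setminus\{0\}$ (the cycle with vertex $0$ and its incident edges removed) is a path of Type $n$. -}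

module Defs where

open import Level using (0ℓ)
open import Data.Nat using (ℕ; zero; suc; _<_)
open import Data.Fin using (Fin)
open import Data.List using (List; []; _∷_; _++_; [_]; length)
open import Data.List.Membership.Propositional using (_∈_)
open import Data.List.Relation.Unary.Unique.Propositional using (Unique)
open import Data.Product using (Σ; ∃; _×_; _,_)
open import Data.Unit using (⊤)
open import Function.Bundles using (_↔_)
open import Relation.Nullary using (¬_)
open import Relation.Binary.PropositionalEquality using (_≡_; _≢_)
open import Algebra.Structures using (IsCommutativeRing)
open import Relation.Binary.Construct.Closure.Symmetric using (SymClosure)
open import Relation.Binary.Construct.Closure.ReflexiveTransitive using (Star)

record FiniteField (q : ℕ) : Set₁ where
  infixl 7 _*_
  infixl 6 _+_
  field
    Carrier : Set
    _+_ _*_ : Carrier → Carrier → Carrier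
    -_      : Carrier → Carrier
    0# 1#   : Carrier
    isCommutativeRing : IsCommutativeRing _≡_ _+_ _*_ -_ 0# 1#
    0≢1     : 0# ≢ 1#
    inverse : ∀ x → x ≢ 0# → ∃ λ y → x * y ≡ 1#
    card    : Carrier ↔ Fin q

Consecutive : {A : Set} → (A → A → Set) → List A → Set
Consecutive R []            = ⊤
Consecutive R (x ∷ [])      = ⊤
Consecutive R (x ∷ y ∷ xs)  = R x y × Consecutive R (y ∷ xs)

data Weight : Set where
  w0 w1 : Weight

module Graph {q : ℕ} (F : FiniteField q) where
  open FiniteField F

  NonSquare : Carrier → Set
  NonSquare c = ¬ (∃ λ y → y * y ≡ c)

  cubePlus : Carrier → Carrier → Carrier
  cubePlus a x = x * x * x + a

  module _ (lam : Carrier) (f : Carrier → Carrier) where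

    Edge : Carrier → Carrier → Set
    Edge x y = ((y * y + - f x) * (lam * (y * y) + - f x)) ≡ 0#

    WEdge : Weight → Carrier → Carrier → Set
    WEdge w0 x y = y * y ≡ f x
    WEdge w1 x y = Edge x y × ¬ (y * y ≡ f x)

    Connected : Set
    Connected = ∀ x y → Star (SymClosure Edge) x y

    -- Hamiltonian cycle, listed as v₀ … v_{q-1} (closing edge v_{q-1} → v₀)
    IsHamiltonianCycle : List Carrier → Set
    IsHamiltonianCycle c =
      Unique c × (∀ x → x ∈ c) ×
      (∃ λ v → ∃ λ vs → (c ≡ v ∷ vs) × Consecutive Edge (v ∷ vs ++ [ v ]))

    -- a trail of length n inside the path p (given by its vertex list):
    -- a contiguous sub-path with n edges all of the same weight
    HasTrail : List Carrier → ℕ → Set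
    HasTrail p n = Σ Weight λ w → ∃ λ as → ∃ λ vs → ∃ λ bs →
      (p ≡ as ++ vs ++ bs) × (length vs ≡ suc n) × Consecutive (WEdge w) vs

    PathType : ℕ → List Carrier → Set
    PathType n p = HasTrail p n × (∀ m → n < m → ¬ HasTrail p m)

    -- H \ {0}: if the cycle is xs ++ 0 ∷ ys, the remaining path is ys ++ xs
    CycleType : ℕ → List Carrier → Set
    CycleType n c = ∀ xs ys → c ≡ xs ++ 0# ∷ ys → PathType n (ys ++ xs)

module Submission where

-- Rotate the Hamiltonian cycle to 0 → P → 0. Type 1 says that the weights alternate along P,
-- so a vertex y of P with predecessor p and successor s in P satisfies either y² = f(p) and
-- λs² = f(y), or λy² = f(p) and s² = f(y); such neighbours exist unless y is the first vertex v
-- of P or a root of f (the last vertex of P is a root, which also forces a ≠ 0). Compare x with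
-- −x: if both turns have the same shape then f(p₊) = f(p₋), so p₊ = p₋ because cubing is a
-- bijection when 3 ∤ q − 1, and then x = −x since both follow p₊ on the path; otherwise
-- λ(s₊s₋)² = f(x)f(−x). Hence f(x)f(−x) = a² − x⁶ is not a nonzero square when x ≠ 0 and
-- ±x ≠ v. But with t = x³ such x correspond to points (t, z) of the circle t² + z² = a², and
-- its rational parametrisation has at most 9 bad parameters, fewer than q.

open import Defs
open import Algebra.Bundles using (CommutativeRing)
open import Algebra.Structures using (IsCommutativeRing)
open import Data.Empty using (⊥; ⊥-elim)
open import Data.Fin using (Fin; punchOut)
import Data.Fin as Fin
open import Data.Fin.Properties using (any?; punchOut-injective; injective⇒≤)
open import Data.List using (List; []; _∷_; _++_; [_]; length; filter; tabulate; lookup)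
open import Data.List.Properties using (++-assoc; ++-identityʳ; ∷-injective; length-++; length-tabulate; filter-notAll)
open import Data.List.Membership.Propositional using (_∈_; _∉_; lose)
open import Data.List.Membership.Propositional.Properties
  using (∈-++⁺ˡ; ∈-++⁺ʳ; ∈-++⁻; ∈-filter⁺; ∈-filter⁻; ∈-tabulate⁺; ∈-∃++)
open import Data.List.Membership.Propositional.Properties.WithK using (unique∧set⇒bag)
open import Data.List.Relation.Binary.BagAndSetEquality using (∼bag⇒↭)
open import Data.List.Relation.Binary.Permutation.Propositional using (↭⇒↭ₛ)
open import Data.List.Relation.Binary.Permutation.Propositional.Properties using (↭-length; ++-comm)
import Data.List.Relation.Binary.Permutation.Setoid.Properties as Permutationₛ
open import Data.List.Relation.Unary.All as All using ([]; _∷_)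
open import Data.List.Relation.Unary.Any as Any using (here; there)
open import Data.List.Relation.Unary.Any.Properties using (lookup-index)
open import Data.List.Relation.Unary.Unique.Propositional using (Unique; []; _∷_)
import Data.List.Relation.Unary.Unique.Propositional.Properties as Unique
open import Data.Nat using (ℕ; zero; suc; _<_; _≤_; _∸_; _^_; z≤n; s≤s)
import Data.Nat as Nat
import Data.Nat.Properties as ℕ
open import Data.Nat.Divisibility using (_∣_; ∣m∣n⇒∣m+n; ∣-refl; divides; ∣1⇒≡1)
open import Data.Nat.Induction using (<-wellFounded)
open import Data.Nat.Primality using (Prime; euclidsLemma; prime[2]; prime⇒irreducible)
open import Data.Product using (Σ; ∃; ∃₂; _×_; _,_; proj₁; proj₂)
open import Data.Sum using (_⊎_; inj₁; inj₂)
open import Data.Unit using (tt)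
open import Function.Bundles using (_⇔_; mk⇔; _↔_; Inverse)
open import Induction.WellFounded using (Acc; acc)
open import Relation.Nullary using (¬_; Dec; yes; no; ¬?)
open import Relation.Binary.Core using (Rel)
open import Relation.Binary.Definitions using (DecidableEquality)
open import Relation.Binary.PropositionalEquality
  using (_≡_; _≢_; refl; sym; trans; cong; cong₂; subst; setoid; ≢-sym; module ≡-Reasoning)

module _ {A : Set} where

  Consecutive-tail : ∀ (R : Rel A _) {x xs} → Consecutive R (x ∷ xs) → Consecutive R xs
  Consecutive-tail R {xs = []}    _       = tt
  Consecutive-tail R {xs = _ ∷ _} (_ , c) = c

  Consecutive-++⁻ʳ : ∀ (R : Rel A _) xs {ys} → Consecutive R (xs ++ ys) → Consecutive R ys
  Consecutive-++⁻ʳ R []       c = c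
  Consecutive-++⁻ʳ R (x ∷ xs) c = Consecutive-++⁻ʳ R xs (Consecutive-tail R c)

  Consecutive-++⁻ : ∀ (R : Rel A _) xs {b ys} → Consecutive R (xs ++ b ∷ ys) →
                    Consecutive R (xs ++ [ b ]) × Consecutive R (b ∷ ys)
  Consecutive-++⁻ R []           c       = tt , c
  Consecutive-++⁻ R (x ∷ [])     (r , c) = (r , tt) , c
  Consecutive-++⁻ R (x ∷ y ∷ xs) (r , c) with c₁ , c₂ ← Consecutive-++⁻ R (y ∷ xs) c = (r , c₁) , c₂

  Consecutive-++⁺ : ∀ (R : Rel A _) xs {b ys} → Consecutive R (xs ++ [ b ]) → Consecutive R (b ∷ ys) →
                    Consecutive R (xs ++ b ∷ ys)
  Consecutive-++⁺ R []           _       c = c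
  Consecutive-++⁺ R (x ∷ [])     (r , _) c = r , c
  Consecutive-++⁺ R (x ∷ y ∷ xs) (r , c) d = r , Consecutive-++⁺ R (y ∷ xs) c d

  Consecutive-rotate : ∀ (R : Rel A _) {v vs} xs {z} ys → v ∷ vs ≡ xs ++ z ∷ ys →
                       Consecutive R (v ∷ vs ++ [ v ]) → Consecutive R (z ∷ (ys ++ xs) ++ [ z ])
  Consecutive-rotate R [] ys refl c rewrite ++-identityʳ ys = c
  Consecutive-rotate R (x ∷ xs) {z} ys refl c
    rewrite ++-assoc ys (x ∷ xs) [ z ] =
      Consecutive-++⁺ R (z ∷ ys) (proj₂ split) (proj₁ split)
    where
    split : Consecutive R ((x ∷ xs) ++ [ z ]) × Consecutive R (z ∷ ys ++ [ x ])
    split = Consecutive-++⁻ R (x ∷ xs) (subst (λ l → Consecutive R (x ∷ l)) (++-assoc xs (z ∷ ys) [ x ]) c)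

  Unique-++-comm : ∀ xs {ys : List A} → Unique (xs ++ ys) → Unique (ys ++ xs)
  Unique-++-comm xs {ys} =
    Permutationₛ.AllPairs-resp-↭ (setoid A) ≢-sym ((λ { refl p → p }) , (λ { refl p → p }))
      (↭⇒↭ₛ (++-comm xs ys))

  Unique-successor : ∀ (xs xs′ : List A) {p y y′ ys ys′} → Unique (xs ++ p ∷ y ∷ ys) →
                     xs ++ p ∷ y ∷ ys ≡ xs′ ++ p ∷ y′ ∷ ys′ → y ≡ y′
  Unique-successor []       []         _ eq = proj₁ (∷-injective (proj₂ (∷-injective eq)))
  Unique-successor []       (x ∷ xs′)  u eq =
    ⊥-elim (Unique.Unique[x∷xs]⇒x∉xs u (subst (_ ∈_) (sym (proj₂ (∷-injective eq))) (∈-++⁺ʳ xs′ (here refl))))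
  Unique-successor (x ∷ xs) []         u eq with refl ← proj₁ (∷-injective eq) =
    ⊥-elim (Unique.Unique[x∷xs]⇒x∉xs u (∈-++⁺ʳ xs (here refl)))
  Unique-successor (x ∷ xs) (x′ ∷ xs′) (_ ∷ u) eq = Unique-successor xs xs′ u (proj₂ (∷-injective eq))

  ∈⇒predecessor : ∀ (v : A) {xs y} → y ∈ xs → ∃₂ λ ys p → ∃ λ zs → v ∷ xs ≡ ys ++ p ∷ y ∷ zs
  ∈⇒predecessor v (here refl) = [] , v , _ , refl
  ∈⇒predecessor v (there y∈xs) with ys , p , zs , eq ← ∈⇒predecessor _ y∈xs = v ∷ ys , p , zs , cong (v ∷_) eq

  ∃-last : ∀ (v : A) xs → ∃₂ λ ys u → v ∷ xs ≡ ys ++ [ u ]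
  ∃-last v []       = [] , v , refl
  ∃-last v (x ∷ xs) with ys , u , eq ← ∃-last x xs = v ∷ ys , u , cong (v ∷_) eq

  Unique∧set-equal⇒length≡ : ∀ {xs ys : List A} → Unique xs → Unique ys →
                            (∀ {x} → x ∈ xs ⇔ x ∈ ys) → length xs ≡ length ys
  Unique∧set-equal⇒length≡ xs! ys! xs∼ys = ↭-length (∼bag⇒↭ (unique∧set⇒bag xs! ys! xs∼ys))

  length-++-≤ : ∀ (xs : List A) {ys m n} → length xs ≤ m → length ys ≤ n → length (xs ++ ys) ≤ m Nat.+ n
  length-++-≤ xs xs≤m ys≤n = ℕ.≤-trans (ℕ.≤-reflexive (length-++ xs)) (ℕ.+-mono-≤ xs≤m ys≤n)

-- Counting by equivalence classes

module _ {A : Set} (_≟_ : DecidableEquality A) (class : A → List A)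
         (class-sym : ∀ {x y} → y ∈ class x → x ∈ class y)
         (class-trans : ∀ {x y z} → y ∈ class x → z ∈ class y → z ∈ class x) where

  open import Data.List.Membership.DecPropositional _≟_ using (_∈?_)

  ClassesOfSize : ℕ → List A → Set
  ClassesOfSize n xs = ∀ {x} → x ∈ xs → x ∈ class x × Unique (class x) × length (class x) ≡ n

  UnionOfClasses : List A → Set
  UnionOfClasses xs = ∀ {x y} → x ∈ xs → y ∈ class x → y ∈ xs

  outside? : ∀ z x → Dec (x ∉ class z)
  outside? z x = ¬? (x ∈? class z)

  without : A → List A → List A
  without z = filter (outside? z)

  ∈-without⁻ : ∀ {z} xs {x} → x ∈ without z xs → x ∈ xs × x ∉ class z
  ∈-without⁻ {z} xs = ∈-filter⁻ (outside? z) {xs = xs}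

  length-without : ∀ {z xs} → Unique xs → Unique (class z) → (∀ {y} → y ∈ class z → y ∈ xs) →
                   length xs ≡ length (class z) Nat.+ length (without z xs)
  length-without {z} {xs} xs! class! class⊆xs = begin
    length xs                                   ≡⟨ Unique∧set-equal⇒length≡ xs!
                                                     (Unique.++⁺ class! (Unique.filter⁺ (outside? z) xs!) disjoint)
                                                     (mk⇔ split unsplit) ⟩
    length (class z ++ without z xs)            ≡⟨ length-++ (class z) ⟩
    length (class z) Nat.+ length (without z xs) ∎
    where
    open ≡-Reasoning
    disjoint : ∀ {x} → x ∈ class z × x ∈ without z xs → ⊥
    disjoint (x∈class , x∈without) = proj₂ (∈-without⁻ xs x∈without) x∈class
    split : ∀ {x} → x ∈ xs → x ∈ class z ++ without z xs
    split {x} x∈xs with x ∈? class z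
    ... | yes x∈class = ∈-++⁺ˡ x∈class
    ... | no  x∉class = ∈-++⁺ʳ (class z) (∈-filter⁺ (outside? z) x∈xs x∉class)
    unsplit : ∀ {x} → x ∈ class z ++ without z xs → x ∈ xs
    unsplit x∈ with ∈-++⁻ (class z) x∈
    ... | inj₁ x∈class   = class⊆xs x∈class
    ... | inj₂ x∈without = proj₁ (∈-without⁻ xs x∈without)

  without-union : ∀ {z xs} → UnionOfClasses xs → UnionOfClasses (without z xs)
  without-union {z} {xs} closed x∈without y∈class =
    let x∈xs , x∉class = ∈-without⁻ xs x∈without
    in ∈-filter⁺ (outside? z) (closed x∈xs y∈class)
         (λ y∈class-z → x∉class (class-trans y∈class-z (class-sym y∈class)))

  classesOfSize⇒∣length : ∀ n {xs} → Unique xs → ClassesOfSize n xs → UnionOfClasses xs → n ∣ length xs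
  classesOfSize⇒∣length n {xs} = go xs (<-wellFounded (length xs))
    where
    go : ∀ xs → Acc _<_ (length xs) → Unique xs → ClassesOfSize n xs → UnionOfClasses xs → n ∣ length xs
    go []         _         _   _    _      = divides 0 refl
    go xs@(z ∷ _) (acc rec) xs! size closed with z∈class , class! , refl ← size (here refl) =
      subst (n ∣_) (sym (length-without xs! class! (closed (here refl))))
        (∣m∣n⇒∣m+n ∣-refl (go (without z xs) (rec shorter) (Unique.filter⁺ (outside? z) xs!)
                              (λ x∈ → size (proj₁ (∈-without⁻ xs x∈))) (without-union closed)))
      where
      shorter : length (without z xs) < length xs
      shorter = filter-notAll (outside? z) xs (here (λ z∉class → z∉class z∈class))

module _ {A : Set} (_≟_ : DecidableEquality A) (σ : A → A) where

  involution⇒2∣length : (∀ x → σ (σ x) ≡ x) → ∀ {xs} → Unique xs →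
                        (∀ {x} → x ∈ xs → σ x ∈ xs) → (∀ {x} → x ∈ xs → σ x ≢ x) → 2 ∣ length xs
  involution⇒2∣length σ² {xs} xs! σ-closed σ-free =
    classesOfSize⇒∣length _≟_ orbit orbit-sym orbit-trans 2 xs! size closed
    where
    orbit : A → List A
    orbit x = x ∷ σ x ∷ []
    orbit-sym : ∀ {x y} → y ∈ orbit x → x ∈ orbit y
    orbit-sym         (here refl)         = here refl
    orbit-sym {x = x} (there (here refl)) = there (here (sym (σ² x)))
    orbit-trans : ∀ {x y z} → y ∈ orbit x → z ∈ orbit y → z ∈ orbit x
    orbit-trans         (here refl)         z∈ = z∈
    orbit-trans         (there (here refl)) (here z≡)         = there (here z≡)
    orbit-trans {x = x} (there (here refl)) (there (here z≡)) = here (trans z≡ (σ² x))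
    size : ∀ {x} → x ∈ xs → x ∈ orbit x × Unique (orbit x) × length (orbit x) ≡ 2
    size x∈xs = here refl , ((λ x≡σx → σ-free x∈xs (sym x≡σx)) ∷ []) ∷ [] ∷ [] , refl
    closed : ∀ {x y} → x ∈ xs → y ∈ orbit x → y ∈ xs
    closed x∈xs (here refl)         = x∈xs
    closed x∈xs (there (here refl)) = σ-closed x∈xs

  order3⇒3∣length : (∀ x → σ (σ (σ x)) ≡ x) → ∀ {xs} → Unique xs →
                    (∀ {x} → x ∈ xs → σ x ∈ xs) → (∀ {x} → x ∈ xs → σ x ≢ x) → 3 ∣ length xs
  order3⇒3∣length σ³ {xs} xs! σ-closed σ-free =
    classesOfSize⇒∣length _≟_ orbit orbit-sym orbit-trans 3 xs! size closed
    where
    orbit : A → List A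
    orbit x = x ∷ σ x ∷ σ (σ x) ∷ []
    orbit-sym : ∀ {x y} → y ∈ orbit x → x ∈ orbit y
    orbit-sym         (here refl)                 = here refl
    orbit-sym {x = x} (there (here refl))         = there (there (here (sym (σ³ x))))
    orbit-sym {x = x} (there (there (here refl))) = there (here (sym (σ³ x)))
    orbit-trans : ∀ {x y z} → y ∈ orbit x → z ∈ orbit y → z ∈ orbit x
    orbit-trans         (here refl)                 z∈ = z∈
    orbit-trans         (there (here refl))         (here z≡)                 = there (here z≡)
    orbit-trans         (there (here refl))         (there (here z≡))         = there (there (here z≡))
    orbit-trans {x = x} (there (here refl))         (there (there (here z≡))) = here (trans z≡ (σ³ x))
    orbit-trans         (there (there (here refl))) (here z≡)                 = there (there (here z≡))
    orbit-trans {x = x} (there (there (here refl))) (there (here z≡))         = here (trans z≡ (σ³ x))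
    orbit-trans {x = x} (there (there (here refl))) (there (there (here z≡))) =
      there (here (trans z≡ (cong σ (σ³ x))))
    size : ∀ {x} → x ∈ xs → x ∈ orbit x × Unique (orbit x) × length (orbit x) ≡ 3
    size {x} x∈xs = here refl , ((x≢σx ∷ x≢σσx ∷ []) ∷ (σx≢σσx ∷ []) ∷ [] ∷ []) , refl
      where
      x≢σx : x ≢ σ x
      x≢σx x≡σx = σ-free x∈xs (sym x≡σx)
      x≢σσx : x ≢ σ (σ x)
      x≢σσx x≡σσx = x≢σx (trans (sym (σ³ x)) (cong σ (sym x≡σσx)))
      σx≢σσx : σ x ≢ σ (σ x)
      σx≢σσx σx≡σσx = x≢σx (trans (sym (σ³ x)) (trans (cong (λ y → σ (σ y)) σx≡σσx) (σ³ (σ x))))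
    closed : ∀ {x y} → x ∈ xs → y ∈ orbit x → y ∈ xs
    closed x∈xs (here refl)                 = x∈xs
    closed x∈xs (there (here refl))         = σ-closed x∈xs
    closed x∈xs (there (there (here refl))) = σ-closed (σ-closed x∈xs)

Fin-injective⇒surjective : ∀ {n} (g : Fin n → Fin n) → (∀ {i j} → g i ≡ g j → i ≡ j) →
                           ∀ j → ∃ λ i → g i ≡ j
Fin-injective⇒surjective {suc n} g g-injective j with any? (λ i → g i Fin.≟ j)
... | yes hit    = hit
... | no  missed = ⊥-elim (ℕ.<-irrefl refl (injective⇒≤ punched-injective))
  where
  misses : ∀ i → j ≢ g i
  misses i eq = missed (i , sym eq)
  punched-injective : ∀ {i i′} → punchOut (misses i) ≡ punchOut (misses i′) → i ≡ i′
  punched-injective eq = g-injective (punchOut-injective (misses _) (misses _) eq)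

module FiniteType {A : Set} {n : ℕ} (card : A ↔ Fin n) where

  open Inverse card using (to; from; strictlyInverseˡ; strictlyInverseʳ)

  to-injective : ∀ {x y} → to x ≡ to y → x ≡ y
  to-injective {x} {y} eq = trans (sym (strictlyInverseʳ x)) (trans (cong from eq) (strictlyInverseʳ y))

  from-injective : ∀ {i j} → from i ≡ from j → i ≡ j
  from-injective {i} {j} eq = trans (sym (strictlyInverseˡ i)) (trans (cong to eq) (strictlyInverseˡ j))

  infix 4 _≟_

  _≟_ : DecidableEquality A
  x ≟ y with to x Fin.≟ to y
  ... | yes eq = yes (to-injective eq)
  ... | no  ne = no (λ x≡y → ne (cong to x≡y))

  open import Data.List.Membership.DecPropositional _≟_ public using (_∈?_)

  elements : List A
  elements = tabulate from

  elements-unique : Unique elements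
  elements-unique = Unique.tabulate⁺ from-injective

  ∈-elements : ∀ x → x ∈ elements
  ∈-elements x = subst (_∈ elements) (strictlyInverseʳ x) (∈-tabulate⁺ (to x))

  length-elements : length elements ≡ n
  length-elements = length-tabulate from

  ∃∉ : ∀ xs → length xs < n → ∃ λ x → x ∉ xs
  ∃∉ xs short with any? (λ i → ¬? (from i ∈? xs))
  ... | yes (i , from-i∉xs) = from i , from-i∉xs
  ... | no  none = ⊥-elim (ℕ.<⇒≱ short (injective⇒≤ position-injective))
    where
    ∈xs : ∀ i → from i ∈ xs
    ∈xs i with from i ∈? xs
    ... | yes from-i∈xs = from-i∈xs
    ... | no  from-i∉xs = ⊥-elim (none (i , from-i∉xs))
    position-injective : ∀ {i j} → Any.index (∈xs i) ≡ Any.index (∈xs j) → i ≡ j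
    position-injective {i} {j} eq =
      from-injective (trans (lookup-index (∈xs i)) (trans (cong (lookup xs) eq) (sym (lookup-index (∈xs j)))))

  injective⇒surjective : ∀ (f : A → A) → (∀ {x y} → f x ≡ f y → x ≡ y) → ∀ y → ∃ λ x → f x ≡ y
  injective⇒surjective f f-injective y
    with i , eq ← Fin-injective⇒surjective (λ i → to (f (from i)))
                    (λ eq → from-injective (f-injective (to-injective eq))) (to y)
    = from i , to-injective eq

-- Finite fields

module FieldProperties {q : ℕ} (F : FiniteField q) where

  open FiniteField F
  open FiniteType card public using (_≟_; _∈?_; ∃∉; injective⇒surjective)
  open FiniteType card using (elements; elements-unique; ∈-elements; length-elements)

  commutativeRing : CommutativeRing _ _
  commutativeRing = record { isCommutativeRing = isCommutativeRing }

  open IsCommutativeRing isCommutativeRing public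
    using (+-assoc; +-comm; *-assoc; +-identityʳ; -‿inverseˡ; -‿inverseʳ; *-comm; *-identityˡ; *-identityʳ; zeroˡ; zeroʳ)
  open import Algebra.Properties.Ring (CommutativeRing.ring commutativeRing) public
    using (-‿distribˡ-*; -‿distribʳ-*; -‿involutive; -0#≈0#; +-cancelˡ; +-cancelʳ; +-inverseˡ-unique; +-inverseʳ-unique; xyx⁻¹≈y; x∙y⁻¹≈ε⇒x≈y; x≈y⇒x∙y⁻¹≈ε)
  open import Algebra.Solver.Ring.NaturalCoefficients.Default (CommutativeRing.commutativeSemiring commutativeRing)
    public using (solve; _:=_; _:+_; _:*_)
  open ≡-Reasoning

  infix 8 _⁻¹

  _⁻¹ : Carrier → Carrier
  x ⁻¹ with x ≟ 0#
  ... | yes _   = 0#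
  ... | no  x≢0 = proj₁ (inverse x x≢0)

  *-inverseʳ : ∀ {x} → x ≢ 0# → x * x ⁻¹ ≡ 1#
  *-inverseʳ {x} x≢0 with x ≟ 0#
  ... | yes x≡0  = ⊥-elim (x≢0 x≡0)
  ... | no  x≢0′ = proj₂ (inverse x x≢0′)

  *-cancelʳ : ∀ {x y z} → z ≢ 0# → x * z ≡ y * z → x ≡ y
  *-cancelʳ {x} {y} {z} z≢0 eq = begin
    x                ≡⟨ sym (*-identityʳ x) ⟩
    x * 1#           ≡⟨ cong (x *_) (sym (*-inverseʳ z≢0)) ⟩
    x * (z * z ⁻¹)   ≡⟨ sym (*-assoc x z (z ⁻¹)) ⟩
    x * z * z ⁻¹     ≡⟨ cong (_* z ⁻¹) eq ⟩
    y * z * z ⁻¹     ≡⟨ *-assoc y z (z ⁻¹) ⟩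
    y * (z * z ⁻¹)   ≡⟨ cong (y *_) (*-inverseʳ z≢0) ⟩
    y * 1#           ≡⟨ *-identityʳ y ⟩
    y                ∎

  *-cancelˡ : ∀ {x y z} → z ≢ 0# → z * x ≡ z * y → x ≡ y
  *-cancelˡ {x} {y} {z} z≢0 eq = *-cancelʳ z≢0 (trans (*-comm x z) (trans eq (*-comm z y)))

  zero-product : ∀ {x y} → x * y ≡ 0# → x ≡ 0# ⊎ y ≡ 0#
  zero-product {x} {y} xy≡0 with x ≟ 0#
  ... | yes x≡0 = inj₁ x≡0
  ... | no  x≢0 = inj₂ (*-cancelˡ x≢0 (trans xy≡0 (sym (zeroʳ x))))

  *-nonzero : ∀ {x y} → x ≢ 0# → y ≢ 0# → x * y ≢ 0#
  *-nonzero x≢0 y≢0 xy≡0 with zero-product xy≡0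
  ... | inj₁ x≡0 = x≢0 x≡0
  ... | inj₂ y≡0 = y≢0 y≡0

  nonzero-factorˡ : ∀ {x y} → x * y ≢ 0# → x ≢ 0#
  nonzero-factorˡ {y = y} xy≢0 refl = xy≢0 (zeroˡ y)

  nonzero-factorʳ : ∀ {x y} → x * y ≢ 0# → y ≢ 0#
  nonzero-factorʳ {x} xy≢0 refl = xy≢0 (zeroʳ x)

  square≡0⇒≡0 : ∀ {x} → x * x ≡ 0# → x ≡ 0#
  square≡0⇒≡0 xx≡0 with zero-product xx≡0
  ... | inj₁ x≡0 = x≡0
  ... | inj₂ x≡0 = x≡0

  -x*-x≡x*x : ∀ x → - x * - x ≡ x * x
  -x*-x≡x*x x = begin
    - x * - x      ≡⟨ sym (-‿distribˡ-* x (- x)) ⟩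
    - (x * - x)    ≡⟨ cong -_ (sym (-‿distribʳ-* x x)) ⟩
    - - (x * x)    ≡⟨ -‿involutive (x * x) ⟩
    x * x          ∎

  difference-of-squares : ∀ x y → (x + y) * (x + - y) ≡ x * x + - (y * y)
  difference-of-squares x y = begin
    (x + y) * (x + - y)                 ≡⟨ solve 3 (λ x y n → (x :+ y) :* (x :+ n) := x :* x :+ y :* n :+ x :* (y :+ n))
                                                    refl x y (- y) ⟩
    x * x + y * - y + x * (y + - y)     ≡⟨ cong (λ z → x * x + y * - y + x * z) (-‿inverseʳ y) ⟩
    x * x + y * - y + x * 0#            ≡⟨ trans (cong (x * x + y * - y +_) (zeroʳ x)) (+-identityʳ _) ⟩
    x * x + y * - y                     ≡⟨ cong (x * x +_) (sym (-‿distribʳ-* y y)) ⟩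
    x * x + - (y * y)                   ∎

  equal-squares : ∀ {x y} → x * x ≡ y * y → x ≡ y ⊎ x ≡ - y
  equal-squares {x} {y} xx≡yy with zero-product (trans (difference-of-squares x y) (x≈y⇒x∙y⁻¹≈ε xx≡yy))
  ... | inj₁ x+y≡0  = inj₂ (+-inverseˡ-unique x y x+y≡0)
  ... | inj₂ x-y≡0  = inj₁ (x∙y⁻¹≈ε⇒x≈y x y x-y≡0)

  quadratic-roots : ∀ {b} → b ≢ 0# → ∀ d →
                    Σ (List Carrier) λ rs → length rs ≤ 2 × (∀ {m} → b * (m * m) ≡ d → m ∈ rs)
  quadratic-roots {b} b≢0 d with Any.any? (λ m → b * (m * m) ≟ d) elements
  ... | yes root = m₀ ∷ - m₀ ∷ [] , ℕ.≤-refl , is-root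
    where
    m₀ : Carrier
    m₀ = proj₁ (Any.satisfied root)
    is-root : ∀ {m} → b * (m * m) ≡ d → m ∈ m₀ ∷ - m₀ ∷ []
    is-root eq with equal-squares (*-cancelˡ b≢0 (trans eq (sym (proj₂ (Any.satisfied root)))))
    ... | inj₁ m≡m₀  = here m≡m₀
    ... | inj₂ m≡-m₀ = there (here m≡-m₀)
  ... | no  none = [] , z≤n , λ {m} eq → ⊥-elim (none (lose (∈-elements m) eq))

  1+1≢0 : ¬ 2 ∣ q → 1# + 1# ≢ 0#
  1+1≢0 2∤q 1+1≡0 = 2∤q (subst (2 ∣_) length-elements
    (involution⇒2∣length _≟_ (_+ 1#) twice elements-unique (λ _ → ∈-elements _) (λ _ → not-fixed)))
    where
    twice : ∀ x → x + 1# + 1# ≡ x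
    twice x = begin
      x + 1# + 1#    ≡⟨ +-assoc x 1# 1# ⟩
      x + (1# + 1#)  ≡⟨ cong (x +_) 1+1≡0 ⟩
      x + 0#         ≡⟨ +-identityʳ x ⟩
      x              ∎
    not-fixed : ∀ {x} → x + 1# ≢ x
    not-fixed {x} x+1≡x = 0≢1 (sym (+-cancelˡ x 1# 0# (trans x+1≡x (sym (+-identityʳ x)))))

  nonzero : List Carrier
  nonzero = filter (λ x → ¬? (x ≟ 0#)) elements

  ∈-nonzero : ∀ {x} → x ≢ 0# → x ∈ nonzero
  ∈-nonzero x≢0 = ∈-filter⁺ (λ x → ¬? (x ≟ 0#)) (∈-elements _) x≢0

  ∈-nonzero⁻ : ∀ {x} → x ∈ nonzero → x ≢ 0#
  ∈-nonzero⁻ x∈ = proj₂ (∈-filter⁻ (λ x → ¬? (x ≟ 0#)) {xs = elements} x∈)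

  nonzero-unique : Unique nonzero
  nonzero-unique = Unique.filter⁺ (λ x → ¬? (x ≟ 0#)) {elements} elements-unique

  length-nonzero : length nonzero ≡ q ∸ 1
  length-nonzero = cong (_∸ 1) (trans (sym elements∼0∷nonzero) length-elements)
    where
    0∷nonzero-unique : Unique (0# ∷ nonzero)
    0∷nonzero-unique = All.tabulate (λ x∈ 0≡x → ∈-nonzero⁻ x∈ (sym 0≡x))
                     ∷ nonzero-unique
    split : ∀ {x} → x ∈ elements ⇔ x ∈ 0# ∷ nonzero
    split {x} = mk⇔ (λ _ → case-zero (x ≟ 0#)) (λ _ → ∈-elements x)
      where
      case-zero : Dec (x ≡ 0#) → x ∈ 0# ∷ nonzero
      case-zero (yes x≡0) = here x≡0
      case-zero (no  x≢0) = there (∈-nonzero x≢0)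
    elements∼0∷nonzero : length elements ≡ suc (length nonzero)
    elements∼0∷nonzero = Unique∧set-equal⇒length≡ elements-unique 0∷nonzero-unique split

  cube : Carrier → Carrier
  cube x = x * x * x

  cube-* : ∀ x y → cube (x * y) ≡ cube x * cube y
  cube-* = solve 2 (λ x y → x :* y :* (x :* y) :* (x :* y) := x :* x :* x :* (y :* y :* y)) refl

  cube-1 : cube 1# ≡ 1#
  cube-1 = trans (*-identityʳ (1# * 1#)) (*-identityʳ 1#)

  cube-neg : ∀ x → cube (- x) ≡ - cube x
  cube-neg x = trans (cong (_* - x) (-x*-x≡x*x x)) (sym (-‿distribʳ-* (x * x) x))

  cube≡0⇒≡0 : ∀ {x} → cube x ≡ 0# → x ≡ 0#
  cube≡0⇒≡0 xxx≡0 with zero-product xxx≡0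
  ... | inj₁ xx≡0 = square≡0⇒≡0 xx≡0
  ... | inj₂ x≡0  = x≡0

  cube+a≡0⇒a≢0 : ∀ {a u} → u ≢ 0# → cube u + a ≡ 0# → a ≢ 0#
  cube+a≡0⇒a≢0 {u = u} u≢0 u³+a≡0 refl = u≢0 (cube≡0⇒≡0 (trans (sym (+-identityʳ (cube u))) u³+a≡0))

  cube-root-of-unity : ¬ 3 ∣ q ∸ 1 → ∀ {ω} → cube ω ≡ 1# → ω ≡ 1#
  cube-root-of-unity 3∤q-1 {ω} ω³≡1 with ω ≟ 1#
  ... | yes ω≡1 = ω≡1
  ... | no  ω≢1 = ⊥-elim (3∤q-1 (subst (3 ∣_) length-nonzero
          (order3⇒3∣length _≟_ (ω *_) thrice nonzero-unique
             (λ z∈ → ∈-nonzero (*-nonzero ω≢0 (∈-nonzero⁻ z∈)))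
             (λ z∈ ωz≡z → ω≢1 (*-cancelʳ (∈-nonzero⁻ z∈) (trans ωz≡z (sym (*-identityˡ _))))))))
    where
    ω≢0 : ω ≢ 0#
    ω≢0 ω≡0 = 0≢1 (trans (sym (trans (cong cube ω≡0) (zeroʳ _))) ω³≡1)
    thrice : ∀ z → ω * (ω * (ω * z)) ≡ z
    thrice z = begin
      ω * (ω * (ω * z))   ≡⟨ solve 2 (λ ω z → ω :* (ω :* (ω :* z)) := ω :* ω :* ω :* z) refl ω z ⟩
      cube ω * z          ≡⟨ cong (_* z) ω³≡1 ⟩
      1# * z              ≡⟨ *-identityˡ z ⟩
      z                   ∎

  cube-injective : ¬ 3 ∣ q ∸ 1 → ∀ {x y} → cube x ≡ cube y → x ≡ y
  cube-injective 3∤q-1 {x} {y} x³≡y³ with y ≟ 0#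
  ... | yes y≡0 = trans (cube≡0⇒≡0 (trans x³≡y³ (trans (cong cube y≡0) (zeroʳ _)))) (sym y≡0)
  ... | no  y≢0 = begin
    x                  ≡⟨ sym (*-identityʳ x) ⟩
    x * 1#             ≡⟨ cong (x *_) (sym (trans (*-comm _ _) (*-inverseʳ y≢0))) ⟩
    x * (y ⁻¹ * y)     ≡⟨ sym (*-assoc x (y ⁻¹) y) ⟩
    x * y ⁻¹ * y       ≡⟨ cong (_* y) (cube-root-of-unity 3∤q-1 ratio³≡1) ⟩
    1# * y             ≡⟨ *-identityˡ y ⟩
    y                  ∎
    where
    ratio³≡1 : cube (x * y ⁻¹) ≡ 1#
    ratio³≡1 = begin
      cube (x * y ⁻¹)         ≡⟨ cube-* x (y ⁻¹) ⟩
      cube x * cube (y ⁻¹)    ≡⟨ cong (_* cube (y ⁻¹)) x³≡y³ ⟩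
      cube y * cube (y ⁻¹)    ≡⟨ sym (cube-* y (y ⁻¹)) ⟩
      cube (y * y ⁻¹)         ≡⟨ cong cube (*-inverseʳ y≢0) ⟩
      cube 1#                 ≡⟨ cube-1 ⟩
      1#                      ∎

  cube-surjective : ¬ 3 ∣ q ∸ 1 → ∀ t → ∃ λ x → cube x ≡ t
  cube-surjective 3∤q-1 = injective⇒surjective cube (cube-injective 3∤q-1)

  x+x≢0 : 1# + 1# ≢ 0# → ∀ {x} → x ≢ 0# → x + x ≢ 0#
  x+x≢0 2≢0 {x} x≢0 x+x≡0 = *-nonzero 2≢0 x≢0 (begin
    (1# + 1#) * x    ≡⟨ solve 2 (λ o x → (o :+ o) :* x := o :* x :+ o :* x) refl 1# x ⟩
    1# * x + 1# * x  ≡⟨ cong₂ _+_ (*-identityˡ x) (*-identityˡ x) ⟩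
    x + x            ≡⟨ x+x≡0 ⟩
    0#               ∎)

  x≢-x : 1# + 1# ≢ 0# → ∀ {x} → x ≢ 0# → x ≢ - x
  x≢-x 2≢0 {x} x≢0 x≡-x = x+x≢0 2≢0 x≢0 (trans (cong (x +_) x≡-x) (-‿inverseʳ x))

  nonsquare-multiple : ∀ {c} → Graph.NonSquare F c → ∀ {r s} → s ≢ 0# → c * (r * r) ≢ s * s
  nonsquare-multiple {c} nonsquare {r} {s} s≢0 crr≡ss with r ≟ 0#
  ... | yes refl = s≢0 (square≡0⇒≡0 (trans (sym crr≡ss) (trans (cong (c *_) (zeroʳ 0#)) (zeroʳ c))))
  ... | no  r≢0  = nonsquare (s * r ⁻¹ , (begin
    s * r ⁻¹ * (s * r ⁻¹)             ≡⟨ solve 2 (λ s i → s :* i :* (s :* i) := s :* s :* (i :* i)) refl s (r ⁻¹) ⟩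
    s * s * (r ⁻¹ * r ⁻¹)             ≡⟨ cong (_* (r ⁻¹ * r ⁻¹)) (sym crr≡ss) ⟩
    c * (r * r) * (r ⁻¹ * r ⁻¹)       ≡⟨ solve 3 (λ c r i → c :* (r :* r) :* (i :* i) := c :* (r :* i :* (r :* i)))
                                                 refl c r (r ⁻¹) ⟩
    c * (r * r ⁻¹ * (r * r ⁻¹))       ≡⟨ cong (λ u → c * (u * u)) (*-inverseʳ r≢0) ⟩
    c * (1# * 1#)                     ≡⟨ trans (cong (c *_) (*-identityʳ 1#)) (*-identityʳ c) ⟩
    c                                 ∎))

  -- Rational parametrisation of the circle t² + z² = a².
  module Circle (a : Carrier) where

    t z : Carrier → Carrier
    t m = a * (1# + - (m * m)) * (1# + m * m) ⁻¹
    z m = (a + a) * m * (1# + m * m) ⁻¹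

    1-w+w≡1 : ∀ w → 1# + - w + w ≡ 1#
    1-w+w≡1 w = trans (+-assoc 1# (- w) w) (trans (cong (1# +_) (-‿inverseˡ w)) (+-identityʳ 1#))

    on-circle : ∀ {m} → 1# + m * m ≢ 0# → a * a ≡ t m * t m + z m * z m
    on-circle {m} u≢0 = begin
      a * a                                     ≡⟨ sym (trans (cong (λ k → a * a * (k * k)) u*i≡1)
                                                     (trans (cong (a * a *_) (*-identityʳ 1#)) (*-identityʳ _))) ⟩
      a * a * ((d + w + w) * i * ((d + w + w) * i))
        ≡⟨ solve 4 (λ a d m i → a :* a :* ((d :+ m :* m :+ m :* m) :* i :* ((d :+ m :* m :+ m :* m) :* i))
                              := a :* d :* i :* (a :* d :* i) :+ (a :+ a) :* m :* i :* ((a :+ a) :* m :* i) :* (d :+ m :* m))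
                   refl a d m i ⟩
      t m * t m + z m * z m * (d + w)           ≡⟨ cong (λ k → t m * t m + z m * z m * k) (1-w+w≡1 w) ⟩
      t m * t m + z m * z m * 1#                ≡⟨ cong (t m * t m +_) (*-identityʳ _) ⟩
      t m * t m + z m * z m                     ∎
      where
      -- d = 1 - m² is kept atomic, with d + m² = 1, so that the middle step is a semiring identity.
      w d i : Carrier
      w = m * m
      d = 1# + - w
      i = (1# + w) ⁻¹
      u*i≡1 : (d + w + w) * i ≡ 1#
      u*i≡1 = trans (cong (λ k → (k + w) * i) (1-w+w≡1 w)) (*-inverseʳ u≢0)

    circle-product : ∀ {m} → 1# + m * m ≢ 0# → (t m + a) * (- t m + a) ≡ z m * z m
    circle-product {m} u≢0 = begin
      (t m + a) * (- t m + a)               ≡⟨ cong₂ _*_ (+-comm (t m) a) (+-comm (- t m) a) ⟩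
      (a + t m) * (a + - t m)               ≡⟨ difference-of-squares a (t m) ⟩
      a * a + - (t m * t m)                 ≡⟨ cong (_+ - (t m * t m)) (on-circle u≢0) ⟩
      t m * t m + z m * z m + - (t m * t m) ≡⟨ xyx⁻¹≈y (t m * t m) (z m * z m) ⟩
      z m * z m                             ∎

    t≡c⇒ : ∀ {m c} → 1# + m * m ≢ 0# → t m ≡ c → (a + c) * (m * m) ≡ a + - c
    t≡c⇒ {m} {c} u≢0 t≡c = begin
      (a + c) * w                 ≡⟨ sym (xyx⁻¹≈y c _) ⟩
      c + (a + c) * w + - c       ≡⟨ cong (_+ - c) (sym a≡c+[a+c]w) ⟩
      a + - c                     ∎
      where
      w d u : Carrier
      w = m * m
      d = 1# + - w
      u = 1# + w
      ad≡cu : a * d ≡ c * u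
      ad≡cu = begin
        a * d                     ≡⟨ sym (*-identityʳ (a * d)) ⟩
        a * d * 1#                ≡⟨ cong (a * d *_) (sym (trans (*-comm (u ⁻¹) u) (*-inverseʳ u≢0))) ⟩
        a * d * (u ⁻¹ * u)        ≡⟨ sym (*-assoc (a * d) (u ⁻¹) u) ⟩
        t m * u                   ≡⟨ cong (_* u) t≡c ⟩
        c * u                     ∎
      a≡c+[a+c]w : a ≡ c + (a + c) * w
      a≡c+[a+c]w = begin
        a                         ≡⟨ sym (*-identityʳ a) ⟩
        a * 1#                    ≡⟨ cong (a *_) (sym (1-w+w≡1 w)) ⟩
        a * (d + w)               ≡⟨ solve 3 (λ a d w → a :* (d :+ w) := a :* d :+ a :* w) refl a d w ⟩
        a * d + a * w             ≡⟨ cong (_+ a * w) ad≡cu ⟩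
        c * u + a * w             ≡⟨ solve 4 (λ c o w a → c :* (o :+ w) :+ a :* w := c :* o :+ (a :+ c) :* w)
                                             refl c 1# w a ⟩
        c * 1# + (a + c) * w      ≡⟨ cong (_+ (a + c) * w) (*-identityʳ c) ⟩
        c + (a + c) * w           ∎

    module _ (2≢0 : 1# + 1# ≢ 0#) (a≢0 : a ≢ 0#) where

      t-preimage : ∀ c → Σ (List Carrier) λ ms → length ms ≤ 2 × (∀ {m} → 1# + m * m ≢ 0# → t m ≡ c → m ∈ ms)
      t-preimage c with a + c ≟ 0#
      ... | no  a+c≢0 with ms , length≤2 , ∈ms ← quadratic-roots a+c≢0 (a + - c) =
        ms , length≤2 , λ u≢0 t≡c → ∈ms (t≡c⇒ u≢0 t≡c)
      ... | yes a+c≡0 = [] , z≤n , λ u≢0 t≡c → ⊥-elim (x+x≢0 2≢0 a≢0 (trans (cong (a +_) (a≡c u≢0 t≡c)) a+c≡0))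
        where
        a≡c : ∀ {m} → 1# + m * m ≢ 0# → t m ≡ c → a ≡ c
        a≡c {m} u≢0 t≡c = x∙y⁻¹≈ε⇒x≈y a c
          (trans (sym (t≡c⇒ u≢0 t≡c)) (trans (cong (_* (m * m)) a+c≡0) (zeroˡ (m * m))))

      z-nonzero : ∀ {m} → m ≢ 0# → 1# + m * m ≢ 0# → z m ≢ 0#
      z-nonzero {m} m≢0 u≢0 = *-nonzero (*-nonzero (x+x≢0 2≢0 a≢0) m≢0) u⁻¹≢0
        where
        u⁻¹≢0 : (1# + m * m) ⁻¹ ≢ 0#
        u⁻¹≢0 u⁻¹≡0 = 0≢1 (trans (sym (zeroʳ _)) (trans (cong (_ *_) (sym u⁻¹≡0)) (*-inverseʳ u≢0)))

      square-product : ¬ 3 ∣ q ∸ 1 → 9 < q → ∀ v →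
        ∃₂ λ x s → x ≢ 0# × x ≢ v × - x ≢ v × s ≢ 0# × (cube x + a) * (cube (- x) + a) ≡ s * s
      square-product 3∤q-1 9<q v
        -- m avoids 0, the roots of 1 + m², and the m with t m ∈ {0, v³, −v³}.
        with R₋₁ , length-R₋₁ , ∈R₋₁ ← quadratic-roots {1#} (≢-sym 0≢1) (- 1#)
           | R₀ , length-R₀ , ∈R₀ ← t-preimage 0#
           | R₊ , length-R₊ , ∈R₊ ← t-preimage (cube v)
           | R₋ , length-R₋ , ∈R₋ ← t-preimage (- cube v)
        with m , m∉ ← ∃∉ (0# ∷ R₋₁ ++ R₀ ++ R₊ ++ R₋)
                        (ℕ.≤-trans (s≤s (s≤s (length-++-≤ R₋₁ length-R₋₁ (length-++-≤ R₀ length-R₀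
                                                  (length-++-≤ R₊ length-R₊ length-R₋))))) 9<q)
        with x , x³≡t ← cube-surjective 3∤q-1 (t m)
        = x , z m , x≢0 , x≢v , -x≢v , z-nonzero m≢0 u≢0 , product
        where
        m≢0 : m ≢ 0#
        m≢0 m≡0 = m∉ (here m≡0)
        u≢0 : 1# + m * m ≢ 0#
        u≢0 u≡0 = m∉ (there (∈-++⁺ˡ (∈R₋₁ (trans (*-identityˡ _) (+-inverseʳ-unique 1# (m * m) u≡0)))))
        x≢0 : x ≢ 0#
        x≢0 refl = m∉ (there (∈-++⁺ʳ R₋₁ (∈-++⁺ˡ (∈R₀ u≢0 (trans (sym x³≡t) (zeroʳ _))))))
        x≢v : x ≢ v
        x≢v refl = m∉ (there (∈-++⁺ʳ R₋₁ (∈-++⁺ʳ R₀ (∈-++⁺ˡ (∈R₊ u≢0 (sym x³≡t))))))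
        -x≢v : - x ≢ v
        -x≢v refl = m∉ (there (∈-++⁺ʳ R₋₁ (∈-++⁺ʳ R₀ (∈-++⁺ʳ R₊ (∈R₋ u≢0 t≡-v³)))))
          where
          t≡-v³ : t m ≡ - cube (- x)
          t≡-v³ = trans (sym x³≡t) (trans (sym (-‿involutive _)) (cong -_ (sym (cube-neg x))))
        product : (cube x + a) * (cube (- x) + a) ≡ z m * z m
        product = trans (cong₂ (λ u v → (u + a) * (v + a)) x³≡t (trans (cube-neg x) (cong -_ x³≡t)))
                        (circle-product u≢0)

-- The graph G(λ, f)

module _ {q : ℕ} {F : FiniteField q} where

  open FiniteField F
  open Graph F using (NonSquare; Edge; HasTrail; IsHamiltonianCycle; CycleType)
  open FieldProperties F
  open ≡-Reasoning

  module _ {lam : Carrier} {f : Carrier → Carrier} where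

    edge-cases : ∀ {x y} → Edge lam f x y → y * y ≡ f x ⊎ lam * (y * y) ≡ f x
    edge-cases e with zero-product e
    ... | inj₁ d≡0 = inj₁ (x∙y⁻¹≈ε⇒x≈y _ _ d≡0)
    ... | inj₂ d≡0 = inj₂ (x∙y⁻¹≈ε⇒x≈y _ _ d≡0)

    weight-1 : ∀ {x y} → Edge lam f x y → y * y ≢ f x → lam * (y * y) ≡ f x
    weight-1 e not-0 with edge-cases e
    ... | inj₁ yy≡fx  = ⊥-elim (not-0 yy≡fx)
    ... | inj₂ λyy≡fx = λyy≡fx

    edge-into-0 : ∀ {x} → Edge lam f x 0# → f x ≡ 0#
    edge-into-0 e with edge-cases e
    ... | inj₁ 0≡fx = trans (sym 0≡fx) (zeroʳ 0#)
    ... | inj₂ 0≡fx = trans (sym 0≡fx) (trans (cong (lam *_) (zeroʳ 0#)) (zeroʳ lam))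

    -- H rotated to 0 ∷ P, so that P is the path H ∖ {0}.
    record AlternatingCycle (P : List Carrier) : Set where
      field
        unique   : Unique (0# ∷ P)
        edges    : Consecutive (Edge lam f) (0# ∷ P ++ [ 0# ])
        complete : ∀ y → y ≢ 0# → y ∈ P
        no-trail : ¬ HasTrail lam f P 2

    alternating-nonempty : ∀ {P} → AlternatingCycle P → ∃₂ λ v P′ → AlternatingCycle (v ∷ P′)
    alternating-nonempty {[]}    cycle with () ← AlternatingCycle.complete cycle 1# (≢-sym 0≢1)
    alternating-nonempty {v ∷ P} cycle = v , P , cycle

    cycle⇒alternating : ∀ {H} → IsHamiltonianCycle lam f H → CycleType lam f 1 H →
                        ∃₂ λ v P → AlternatingCycle (v ∷ P)
    cycle⇒alternating {H} (H! , ∈H , v , vs , H≡v∷vs , closed) type1 with xs , ys , H≡ ← ∈-∃++ (∈H 0#) =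
      alternating-nonempty (record
        { unique   = Unique-++-comm xs (subst Unique H≡ H!)
        ; edges    = Consecutive-rotate (Edge lam f) xs ys (trans (sym H≡v∷vs) H≡) closed
        ; complete = complete
        ; no-trail = proj₂ (type1 xs ys H≡) 2 (s≤s (s≤s z≤n))
        })
      where
      complete : ∀ y → y ≢ 0# → y ∈ ys ++ xs
      complete y y≢0 with ∈-++⁻ xs (subst (y ∈_) H≡ (∈H y))
      ... | inj₁ y∈xs         = ∈-++⁺ʳ ys y∈xs
      ... | inj₂ (here y≡0)   = ⊥-elim (y≢0 y≡0)
      ... | inj₂ (there y∈ys) = ∈-++⁺ˡ y∈ys

    module _ {v P} (cycle : AlternatingCycle (v ∷ P)) where

      open AlternatingCycle cycle

      suffix-edges : ∀ X {Y} → v ∷ P ≡ X ++ Y → Consecutive (Edge lam f) (Y ++ [ 0# ])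
      suffix-edges X {Y} eq = Consecutive-++⁻ʳ (Edge lam f) (0# ∷ X)
        (subst (λ l → Consecutive (Edge lam f) (0# ∷ l)) (trans (cong (_++ [ 0# ]) eq) (++-assoc X Y [ 0# ])) edges)

      ∉-0 : ∀ {y} → y ∈ v ∷ P → y ≢ 0#
      ∉-0 y∈ refl = Unique.Unique[x∷xs]⇒x∉xs unique y∈

      ∃-root : ∃ λ u → u ≢ 0# × f u ≡ 0#
      ∃-root with X , u , eq ← ∃-last v P =
        u , ∉-0 (subst (u ∈_) (sym eq) (∈-++⁺ʳ X (here refl))) , edge-into-0 (proj₁ (suffix-edges X eq))

      record Neighbours (y : Carrier) : Set where
        field
          before after : List Carrier
          pred succ    : Carrier
          split        : v ∷ P ≡ before ++ pred ∷ y ∷ succ ∷ after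

      neighbours : ∀ {y} → y ≢ 0# → y ≢ v → f y ≢ 0# → Neighbours y
      neighbours {y} y≢0 y≢v fy≢0 with complete y y≢0
      ... | here y≡v = ⊥-elim (y≢v y≡v)
      ... | there y∈P with ∈⇒predecessor v y∈P
      ...   | X , p , [] , eq = ⊥-elim (fy≢0 (edge-into-0 (proj₁ (proj₂ (suffix-edges X eq)))))
      ...   | X , p , s ∷ Y , eq = record { before = X ; after = Y ; pred = p ; succ = s ; split = eq }

      Alternates : Carrier → Carrier → Carrier → Set
      Alternates p y s = (y * y ≡ f p × lam * (s * s) ≡ f y) ⊎ (lam * (y * y) ≡ f p × s * s ≡ f y)

      alternates : ∀ {y} (N : Neighbours y) → Alternates (Neighbours.pred N) y (Neighbours.succ N)
      alternates {y} record { before = X ; pred = p ; succ = s ; split = eq }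
        with p→y , y→s , _ ← suffix-edges X eq | y * y ≟ f p | s * s ≟ f y
      ... | yes p→y:0 | yes y→s:0 = ⊥-elim (no-trail (w0 , X , p ∷ y ∷ s ∷ [] , _ , eq , refl , p→y:0 , y→s:0 , tt))
      ... | yes p→y:0 | no  y→s:1 = inj₁ (p→y:0 , weight-1 y→s y→s:1)
      ... | no  p→y:1 | yes y→s:0 = inj₂ (weight-1 p→y p→y:1 , y→s:0)
      ... | no  p→y:1 | no  y→s:1 =
        ⊥-elim (no-trail (w1 , X , p ∷ y ∷ s ∷ [] , _ , eq , refl , (p→y , p→y:1) , (y→s , y→s:1) , tt))

      successor-unique : ∀ {y y′} (N : Neighbours y) (N′ : Neighbours y′) →
                         Neighbours.pred N ≡ Neighbours.pred N′ → y ≡ y′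
      successor-unique record { before = X ; split = eq } record { before = X′ ; split = eq′ } refl
        with _ ∷ path-unique ← unique
        = Unique-successor X X′ (subst Unique eq path-unique) (trans (sym eq) eq′)

      no-square-product : (∀ {x y} → f x ≡ f y → x ≡ y) → NonSquare lam → 1# + 1# ≢ 0# →
                          ∀ {x s} → x ≢ 0# → x ≢ v → - x ≢ v → s ≢ 0# → f x * f (- x) ≢ s * s
      no-square-product f-injective nonsquare 2≢0 {x} {s} x≢0 x≢v -x≢v s≢0 product =
        compare (alternates N₊) (alternates N₋)
        where
        fx*f-x≢0 : f x * f (- x) ≢ 0#
        fx*f-x≢0 = subst (_≢ 0#) (sym product) (*-nonzero s≢0 s≢0)
        -x≢0 : - x ≢ 0#
        -x≢0 -x≡0 = x≢0 (trans (sym (-‿involutive x)) (trans (cong -_ -x≡0) -0#≈0#))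
        N₊ : Neighbours x
        N₊ = neighbours x≢0 x≢v (nonzero-factorˡ fx*f-x≢0)
        N₋ : Neighbours (- x)
        N₋ = neighbours -x≢0 -x≢v (nonzero-factorʳ fx*f-x≢0)
        open Neighbours N₊ using () renaming (pred to p₊; succ to s₊)
        open Neighbours N₋ using () renaming (pred to p₋; succ to s₋)
        same-pred : f p₊ ≡ f p₋ → ⊥
        same-pred eq = x≢-x 2≢0 x≢0 (successor-unique N₊ N₋ (f-injective eq))
        compare : Alternates p₊ x s₊ → Alternates p₋ (- x) s₋ → ⊥
        compare (inj₁ (xx≡fp₊ , _)) (inj₁ (-x-x≡fp₋ , _)) =
          same-pred (trans (sym xx≡fp₊) (trans (sym (-x*-x≡x*x x)) -x-x≡fp₋))
        compare (inj₂ (λxx≡fp₊ , _)) (inj₂ (λ-x-x≡fp₋ , _)) =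
          same-pred (trans (sym λxx≡fp₊) (trans (cong (lam *_) (sym (-x*-x≡x*x x))) λ-x-x≡fp₋))
        compare (inj₁ (_ , λs₊s₊≡fx)) (inj₂ (_ , s₋s₋≡f-x)) = nonsquare-multiple nonsquare s≢0 (begin
          lam * (s₊ * s₋ * (s₊ * s₋))   ≡⟨ solve 3 (λ l a b → l :* (a :* b :* (a :* b)) := l :* (a :* a) :* (b :* b))
                                                 refl lam s₊ s₋ ⟩
          lam * (s₊ * s₊) * (s₋ * s₋)   ≡⟨ cong₂ _*_ λs₊s₊≡fx s₋s₋≡f-x ⟩
          f x * f (- x)                 ≡⟨ product ⟩
          s * s                         ∎)
        compare (inj₂ (_ , s₊s₊≡fx)) (inj₁ (_ , λs₋s₋≡f-x)) = nonsquare-multiple nonsquare s≢0 (begin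
          lam * (s₊ * s₋ * (s₊ * s₋))   ≡⟨ solve 3 (λ l a b → l :* (a :* b :* (a :* b)) := a :* a :* (l :* (b :* b)))
                                                 refl lam s₊ s₋ ⟩
          s₊ * s₊ * (lam * (s₋ * s₋))   ≡⟨ cong₂ _*_ s₊s₊≡fx λs₋s₋≡f-x ⟩
          f x * f (- x)                 ≡⟨ product ⟩
          s * s                         ∎)

odd-prime-power : ∀ {p} k → Prime p → p ≢ 2 → ¬ 2 ∣ p ^ k
odd-prime-power zero    _       _   2∣1 with () ← ∣1⇒≡1 2∣1
odd-prime-power {p} (suc k) p-prime p≢2 2∣pᵏ⁺¹ with euclidsLemma p (p ^ k) prime[2] 2∣pᵏ⁺¹
... | inj₂ 2∣pᵏ = odd-prime-power k p-prime p≢2 2∣pᵏ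
... | inj₁ 2∣p with prime⇒irreducible p-prime 2∣p
...   | inj₂ 2≡p = p≢2 (sym 2≡p)

corollary2p12 : (q p k : ℕ) → Prime p → p ≢ 2 → q ≡ p ^ k → 17 < q → ¬ (3 ∣ (q ∸ 1)) →
    (F : FiniteField q) → (lam a : FiniteField.Carrier F) →
    Graph.NonSquare F lam →
    Graph.Connected F lam (Graph.cubePlus F a) →
    ¬ (∃ λ (H : List (FiniteField.Carrier F)) →
         Graph.IsHamiltonianCycle F lam (Graph.cubePlus F a) H ×
         Graph.CycleType F lam (Graph.cubePlus F a) 1 H)
corollary2p12 q p k p-prime p≢2 q≡pᵏ 17<q 3∤q-1 F lam a nonsquare _ (H , hamiltonian , type1) =
  let v , P , cycle = cycle⇒alternating hamiltonian type1
      u , u≢0 , u³+a≡0 = ∃-root cycle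
      x , s , x≢0 , x≢v , -x≢v , s≢0 , product =
        Circle.square-product a 2≢0 (cube+a≡0⇒a≢0 u≢0 u³+a≡0) 3∤q-1 (ℕ.≤-trans (ℕ.m≤m+n 10 8) 17<q) v
  in no-square-product cycle cube+a-injective nonsquare 2≢0 x≢0 x≢v -x≢v s≢0 product
  where
  open FiniteField F using (_+_; 0#; 1#)
  open FieldProperties F
  2≢0 : 1# + 1# ≢ 0#
  2≢0 = 1+1≢0 (λ 2∣q → odd-prime-power k p-prime p≢2 (subst (2 ∣_) q≡pᵏ 2∣q))
  cube+a-injective : ∀ {x y} → cube x + a ≡ cube y + a → x ≡ y
  cube+a-injective eq = cube-injective 3∤q-1 (+-cancelʳ a _ _ eq)
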